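{- Let $L$ be a finite semidistributive lattice. For every $j\in\mathrm{JI}(L)$, the pair $\{j,\kappa_\wedge(j)\}$ (with $j$ taken as a join irreducible and $\kappa_\wedge(j)$ as a meet irreducible) is not a face of $\mathrm{CC}(L)$. Consequently, for any bijection $\lambda:\mathrm{JI}(L)\to\{1,\dots,|\mathrm{JI}(L)|\}$, the vertex map sending $j$ to $\mathbf{e}_{\lambda(j)}$ and $\kappa_\wedge(j)$ to $-\mathbf{e}_{\lambda(j)}$ for each $j\in\mathrm{JI}(L)$ defines an embedding of $\mathrm{CC}(L)$ as a subcomplex of the boundary complex of the $|\mathrm{JI}(L)|$-dimensional cross-polytope.
   Context: $L$ is a finite lattice with join $\vee$, meet $\wedge$. $j$ is join irreducible if it covers exactly one element $j_\star$; $m$ is meet irreducible if it is covered by exactly one element $m^\star$; $\mathrm{JI}(L)$, $\mathrm{MI}(L)$ are the sets of such elements. A join representation of $x$ is a set $J$ with $\bigvee J=x$, irredundant if no proper subset has join $x$; irredundant join representations are ordered by $J\le J'$ iff each element of $J$ is below some element of $J'$, and the canonical join representation $\mathrm{CJR}(x)$ is the minimum one if it exists. Dually, the canonical meet representation $\mathrm{CMR}(x)$ is the irredundant meet representation $M$ of $x$ such that for every irredundant meet representation $M'$ of $x$ every element of $M$ is above some element of $M'$. $L$ is semidistributive if all elements have both. For $j\in\mathrm{JI}(L)$, $\kappa_\wedge(j)$ is the unique maximal element of $\{z: z\ge j_\star, z\not\ge j\}$; in a finite semidistributive lattice it exists, lies in $\mathrm{MI}(L)$, and $\kappa_\wedge:\mathrm{JI}(L)\to\mathrm{MI}(L)$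 is a bijection. The canonical complex $\mathrm{CC}(L)$ has ground set the disjoint union $\mathrm{JI}(L)\sqcup\mathrm{MI}(L)$ and faces the disjoint unions $J\sqcup M$ where $J=\mathrm{CJR}(x)$ and $M=\mathrm{CMR}(y)$ for some $x,y\in L$ and $\bigvee J\le\bigwedge M$. The cross-polytope in $\mathbb{R}^d$ is the convex hull of $\pm\mathbf{e}_1,\dots,\pm\mathbf{e}_d$; its boundary complex consists of the vertex sets not containing any antipodal pair $\{\mathbf{e}_i,-\mathbf{e}_i\}$. -}

module Defs where

open import Data.Nat using (ℕ)
open import Data.Fin using (Fin)
open import Data.Fin.Subset using (Subset; _∈_; _⊂_; ⁅_⁆)
open import Data.Bool using (Bool; true; false)
open import Data.Sum using (_⊎_; inj₁; inj₂)
open import Data.Product using (Σ; ∃; ∃-syntax; _×_; _,_)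
open import Relation.Binary.PropositionalEquality using (_≡_)
open import Relation.Nullary using (¬_; Dec)

record FiniteLattice (n : ℕ) : Set₁ where
  infix 4 _≤_
  infixr 6 _∨_
  infixr 7 _∧_
  field
    _≤_       : Fin n → Fin n → Set
    _≤?_      : ∀ x y → Dec (x ≤ y)
    ≤-refl    : ∀ {x} → x ≤ x
    ≤-trans   : ∀ {x y z} → x ≤ y → y ≤ z → x ≤ z
    ≤-antisym : ∀ {x y} → x ≤ y → y ≤ x → x ≡ y
    _∨_       : Fin n → Fin n → Fin n
    x≤x∨y     : ∀ x y → x ≤ x ∨ y
    y≤x∨y     : ∀ x y → y ≤ x ∨ y
    ∨-least   : ∀ {x y z} → x ≤ z → y ≤ z → x ∨ y ≤ z
    _∧_       : Fin n → Fin n → Fin n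
    x∧y≤x     : ∀ x y → x ∧ y ≤ x
    x∧y≤y     : ∀ x y → x ∧ y ≤ y
    ∧-greatest : ∀ {x y z} → z ≤ x → z ≤ y → z ≤ x ∧ y

module _ {n : ℕ} (L : FiniteLattice n) where
  open FiniteLattice L

  _<_ : Fin n → Fin n → Set
  x < y = x ≤ y × ¬ (x ≡ y)

  _⋖_ : Fin n → Fin n → Set
  x ⋖ y = x < y × (∀ z → x < z → ¬ (z < y))

  IsJIWith : Fin n → Fin n → Set
  IsJIWith j jstar = jstar ⋖ j × (∀ z → z ⋖ j → z ≡ jstar)

  IsJI : Fin n → Set
  IsJI j = ∃[ jstar ] IsJIWith j jstar

  IsMI : Fin n → Set
  IsMI m = ∃[ mstar ] (m ⋖ mstar × (∀ z → m ⋖ z → z ≡ mstar))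

  JoinIs : Subset n → Fin n → Set
  JoinIs J x = (∀ i → i ∈ J → i ≤ x) × (∀ y → (∀ i → i ∈ J → i ≤ y) → x ≤ y)

  MeetIs : Subset n → Fin n → Set
  MeetIs M x = (∀ i → i ∈ M → x ≤ i) × (∀ y → (∀ i → i ∈ M → y ≤ i) → y ≤ x)

  IrredJoinRep : Fin n → Subset n → Set
  IrredJoinRep x J = JoinIs J x × (∀ J' → J' ⊂ J → ¬ JoinIs J' x)

  IrredMeetRep : Fin n → Subset n → Set
  IrredMeetRep x M = MeetIs M x × (∀ M' → M' ⊂ M → ¬ MeetIs M' x)

  IsCJR : Fin n → Subset n → Set
  IsCJR x J = IrredJoinRep x J ×
    (∀ J' → IrredJoinRep x J' → ∀ i → i ∈ J → ∃[ i' ] (i' ∈ J' × i ≤ i'))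

  IsCMR : Fin n → Subset n → Set
  IsCMR x M = IrredMeetRep x M ×
    (∀ M' → IrredMeetRep x M' → ∀ i → i ∈ M → ∃[ i' ] (i' ∈ M' × i' ≤ i))

  Semidistributive : Set
  Semidistributive = ∀ x → (∃[ J ] IsCJR x J) × (∃[ M ] IsCMR x M)

  KSet : Fin n → Fin n → Fin n → Set
  KSet j jstar z = jstar ≤ z × ¬ (j ≤ z)

  MaximalIn : (Fin n → Set) → Fin n → Set
  MaximalIn S m = S m × (∀ z → S z → m ≤ z → z ≡ m)

  IsKappa : Fin n → Fin n → Set
  IsKappa j m = ∃[ jstar ] (IsJIWith j jstar ×
    MaximalIn (KSet j jstar) m × (∀ m' → MaximalIn (KSet j jstar) m' → m' ≡ m))

  -- Faces of the canonical complex: a face J ⊔ M is given by the pair (J , M)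
  -- of its join-irreducible part J and meet-irreducible part M.
  IsFaceCC : Subset n → Subset n → Set
  IsFaceCC J M = ∃[ x ] ∃[ y ] (IsCJR x J × IsCMR y M × x ≤ y)

  -- The ground set JI(L) ⊔ MI(L): inj₁ j for j ∈ JI(L), inj₂ m for m ∈ MI(L)
  IsVertex : Fin n ⊎ Fin n → Set
  IsVertex (inj₁ j) = IsJI j
  IsVertex (inj₂ m) = IsMI m

  InFace : Subset n → Subset n → Fin n ⊎ Fin n → Set
  InFace J M (inj₁ j) = j ∈ J
  InFace J M (inj₂ m) = m ∈ M

-- Vertices of the d-dimensional cross-polytope: (true , i) is e_i,
-- (false , i) is -e_i.
CrossVertex : ℕ → Set
CrossVertex d = Bool × Fin d

-- A vertex set F is a face of the boundary complex of the cross-polytope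
-- iff it contains no antipodal pair {e_i , -e_i}.
IsBoundaryFace : ∀ {d} → (CrossVertex d → Set) → Set
IsBoundaryFace {d} F = ∀ (i : Fin d) → ¬ (F (true , i) × F (false , i))

-- The vertex map: j ↦ e_{λ(j)} and κ_∧(j) ↦ -e_{λ(j)}, where the meet
-- irreducible m is written as κ_∧(κinv m).
vertexMap : ∀ {n d} → (Fin n → Fin d) → (Fin n → Fin n) →
            Fin n ⊎ Fin n → CrossVertex d
vertexMap lam κinv (inj₁ j) = (true , lam j)
vertexMap lam κinv (inj₂ m) = (false , lam (κinv m))

ImageFace : ∀ {n d} (L : FiniteLattice n) → (Fin n → Fin d) → (Fin n → Fin n) →
            Subset n → Subset n → CrossVertex d → Set
ImageFace {n} L lam κinv J M w =
  ∃[ v ] (IsVertex L v × InFace L J M v × vertexMap lam κinv v ≡ w)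

{-# OPTIONS --safe #-}
module Submission where

open import Defs
open import Data.Nat using (ℕ)
open import Data.Fin using (Fin)
open import Data.Fin.Subset using (_∈_; ⁅_⁆)
open import Data.Fin.Subset.Properties using (x∈⁅x⁆)
open import Data.Sum using (inj₁; inj₂)
open import Data.Product using (∃-syntax; _×_; _,_; proj₁; proj₂)
open import Relation.Binary.PropositionalEquality using (_≡_; refl; cong; subst; sym; module ≡-Reasoning)
open import Relation.Nullary using (¬_)

-- Every element of the join part of a face lies below its join x, which lies
-- below the meet y of its meet part; so j ≤ κ(j) would follow if both sat in
-- one face, contradicting j ≰ κ(j). The embedding claims are bookkeeping:
-- λ is injective on JI(L), κ is a bijection JI(L) → MI(L), and an antipodal
-- pair e_i, −e_i in the image would be some j together with κ(j).

module _ {n : ℕ} (L : FiniteLattice n) where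
  open FiniteLattice L

  CJR-≤ : ∀ {x J i} → IsCJR L x J → i ∈ J → i ≤ x
  CJR-≤ {i = i} (((upper , _) , _) , _) = upper i

  CMR-≥ : ∀ {y M i} → IsCMR L y M → i ∈ M → y ≤ i
  CMR-≥ {i = i} (((lower , _) , _) , _) = lower i

  face-join-part-≤-meet-part : ∀ {J M j m} → IsFaceCC L J M → j ∈ J → m ∈ M → j ≤ m
  face-join-part-≤-meet-part (_ , _ , cjr , cmr , x≤y) j∈J m∈M =
    ≤-trans (CJR-≤ cjr j∈J) (≤-trans x≤y (CMR-≥ cmr m∈M))

  kappa-≱ : ∀ {j m} → IsKappa L j m → ¬ j ≤ m
  kappa-≱ (_ , _ , ((_ , j≰m) , _) , _) = j≰m

  kappa-not-in-face : ∀ {J M j m} → IsKappa L j m → IsFaceCC L J M → j ∈ J → ¬ m ∈ M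
  kappa-not-in-face κj face j∈J m∈M = kappa-≱ κj (face-join-part-≤-meet-part face j∈J m∈M)

  module _ {d : ℕ} (κ : Fin n → Fin n) (κinv : Fin n → Fin n)
           (κ∘κinv : ∀ m → IsMI L m → IsJI L (κinv m) × κ (κinv m) ≡ m)
           (lam : Fin n → Fin d)
           (lam-injective : ∀ j j' → IsJI L j → IsJI L j' → lam j ≡ lam j' → j ≡ j')
           where

    lam-κinv-injective : ∀ {j m} → IsJI L j → IsMI L m → lam j ≡ lam (κinv m) → κ j ≡ m
    lam-κinv-injective {j} {m} jJI mMI e with κ∘κinv m mMI
    ... | κinv-mJI , κκinv-m≡m with lam-injective j (κinv m) jJI κinv-mJI e
    ... | refl = κκinv-m≡m

    vertexMap-injective : ∀ v v' → IsVertex L v → IsVertex L v' →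
                          vertexMap lam κinv v ≡ vertexMap lam κinv v' → v ≡ v'
    vertexMap-injective (inj₁ j) (inj₁ j') jJI j'JI e = cong inj₁ (lam-injective j j' jJI j'JI (cong proj₂ e))
    vertexMap-injective (inj₁ _) (inj₂ _) _ _ ()
    vertexMap-injective (inj₂ _) (inj₁ _) _ _ ()
    vertexMap-injective (inj₂ m) (inj₂ m') mMI m'MI e = cong inj₂ (begin
        m                ≡⟨ sym (lam-κinv-injective (proj₁ (κ∘κinv m mMI)) mMI refl) ⟩
        κ (κinv m)       ≡⟨ lam-κinv-injective (proj₁ (κ∘κinv m mMI)) m'MI (cong proj₂ e) ⟩
        m'               ∎)
      where open ≡-Reasoning

    image-face-no-antipodal-pair :
      (∀ j → IsJI L j → IsKappa L j (κ j)) →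
      ∀ J M → IsFaceCC L J M → IsBoundaryFace (ImageFace L lam κinv J M)
    image-face-no-antipodal-pair _ _ _ _ _ ((inj₂ _ , _ , _ , ()) , _)
    image-face-no-antipodal-pair _ _ _ _ _ (_ , (inj₁ _ , _ , _ , ()))
    image-face-no-antipodal-pair isKappa J M face _
      ((inj₁ j , jJI , j∈J , refl) , (inj₂ m , mMI , m∈M , e)) =
      kappa-not-in-face (isKappa j jJI) face j∈J
        (subst (_∈ M) (sym (lam-κinv-injective jJI mMI (sym (cong proj₂ e)))) m∈M)

proposition2p23 : ∀ {n} (L : FiniteLattice n) → Semidistributive L →
    (κ : Fin n → Fin n) → (∀ j → IsJI L j → IsKappa L j (κ j)) →
    (κinv : Fin n → Fin n) →
    (∀ m → IsMI L m → IsJI L (κinv m) × κ (κinv m) ≡ m) →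
    (∀ j → IsJI L j → κinv (κ j) ≡ j) →
    (∀ j → IsJI L j →
      ¬ IsFaceCC L ⁅ j ⁆ ⁅ κ j ⁆)
    × (∀ d (lam : Fin n → Fin d) →
        (∀ j j' → IsJI L j → IsJI L j' → lam j ≡ lam j' → j ≡ j') →
        (∀ i → ∃[ j ] (IsJI L j × lam j ≡ i)) →
        (∀ v v' → IsVertex L v → IsVertex L v' →
           vertexMap lam κinv v ≡ vertexMap lam κinv v' → v ≡ v')
        × (∀ J M → IsFaceCC L J M →
             IsBoundaryFace (ImageFace L lam κinv J M)))
-- Semidistributivity matters only for the existence of κ; once κ is given, it is
-- not used again, and neither are κinv ∘ κ = id nor the surjectivity of λ.
proposition2p23 L _ κ isKappa κinv κ∘κinv _ =
    (λ j jJI face → kappa-not-in-face L (isKappa j jJI) face (x∈⁅x⁆ j) (x∈⁅x⁆ (κ j)))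
  , λ d lam lam-injective _ →
        vertexMap-injective L κ κinv κ∘κinv lam lam-injective
      , image-face-no-antipodal-pair L κ κinv κ∘κinv lam lam-injective isKappa
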